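{- Let $A$ be a finite abelian group and $\emptyset\neq S\subsetneq A$ such that ${\rm Haar}(A,S)$ is disconnected. Let $C$ be the component of ${\rm Haar}(A,S)$ containing $(0,0)$, and let $a\in A$ be such that $(1,-a)\in V(C)$. Then $H=\langle\{x-y:x,y\in a+S\}\rangle$ is a subgroup of $A$, and the vertex sets of the components of ${\rm Haar}(A,a+S)$ are exactly the cosets $(0,x)+({\mathbb Z}_2\times H)=({\mathbb Z}_2)\times(x+H)$, $x\in A$, of ${\mathbb Z}_2\times H$ in ${\mathbb Z}_2\times A$. Consequently ${\rm Haar}(A,a+S)$ is (isomorphic to) the wreath product $\bar K_m\wr{\rm Haar}(H,a+S)$, i.e. the disjoint union of $m$ copies of ${\rm Haar}(H,a+S)$, where $m=|A/H|$.
   Context: $A$ is written additively. For $S\subseteq A$, ${\rm Haar}(A,S)$ is the graph with vertex set ${\mathbb Z}_2\times A$ and edge set $\{(0,g)(1,g+s):g\in A,s\in S\}$; similarly ${\rm Haar}(H,T)$ for $T\subseteq H\le A$. $\bar K_m$ is the edgeless graph on $m$ vertices, and $\bar K_m\wr\Gamma$ is the graph consisting of $m$ disjoint copies of $\Gamma$. -}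

module Defs where

open import Level using (0ℓ)
open import Data.Bool using (Bool; true; false)
open import Data.Nat using (ℕ)
open import Data.Fin using (Fin)
open import Data.Product using (Σ; ∃; ∃-syntax; _×_; _,_; proj₁; proj₂)
open import Data.Empty using (⊥)
open import Relation.Binary.PropositionalEquality using (_≡_; refl; sym; trans; cong)
import Relation.Binary.PropositionalEquality as PE
open import Relation.Binary using (Rel; Setoid; IsEquivalence)
open import Relation.Binary.Construct.Closure.ReflexiveTransitive using (Star)
open import Algebra.Structures using (IsAbelianGroup)
open import Function.Bundles using (_↔_)
open import Algebra.Bundles using (AbelianGroup)
import Algebra.Properties.AbelianGroup as AGP

record FiniteAbelianGroup : Set₁ where
  infixl 6 _+_ _-_
  field
    Carrier        : Set
    _+_            : Carrier → Carrier → Carrier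
    0#             : Carrier
    -_             : Carrier → Carrier
    isAbelianGroup : IsAbelianGroup _≡_ _+_ 0# -_
    size           : ℕ
    enum           : Carrier ↔ Fin size

  _-_ : Carrier → Carrier → Carrier
  x - y = x + (- y)

module _ (G : FiniteAbelianGroup) where
  open FiniteAbelianGroup G

  translate : Carrier → (Carrier → Set) → (Carrier → Set)
  translate a S x = ∃[ s ] (S s × x ≡ a + s)

  diffSet : (Carrier → Set) → (Carrier → Set)
  diffSet T z = ∃[ x ] ∃[ y ] (T x × T y × z ≡ x - y)

  data Generated (X : Carrier → Set) : Carrier → Set where
    gen  : ∀ {x} → X x → Generated X x
    zero : Generated X 0#
    plus : ∀ {x y} → Generated X x → Generated X y → Generated X (x + y)
    neg  : ∀ {x} → Generated X x → Generated X (- x)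

  -- Vertex set ℤ₂ × A (false = 0, true = 1)
  Vertex : Set
  Vertex = Bool × Carrier

  HaarAdj : (Carrier → Set) → Rel Vertex 0ℓ
  HaarAdj S (false , g) (true , h)  = ∃[ s ] (S s × h ≡ g + s)
  HaarAdj S (true , h)  (false , g) = ∃[ s ] (S s × h ≡ g + s)
  HaarAdj S (false , _) (false , _) = ⊥
  HaarAdj S (true , _)  (true , _)  = ⊥

  Connected : (Carrier → Set) → Rel Vertex 0ℓ
  Connected S = Star (HaarAdj S)

  SubVertex : (Carrier → Set) → Set
  SubVertex H = Bool × Σ Carrier H

  SubHaarAdj : (H : Carrier → Set) → (Carrier → Set) → Rel (SubVertex H) 0ℓ
  SubHaarAdj H T (b , g , _) (c , h , _) = HaarAdj T (b , g) (c , h)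

  -- Equality of vertices of Haar(H,T): elements of H are compared as elements of A
  subVertexSetoid : (H : Carrier → Set) → Setoid 0ℓ 0ℓ
  subVertexSetoid H = record
    { Carrier = SubVertex H
    ; _≈_ = λ u v → (proj₁ u ≡ proj₁ v) × (proj₁ (proj₂ u) ≡ proj₁ (proj₂ v))
    ; isEquivalence = record
      { refl = refl , refl
      ; sym = λ { (p , q) → sym p , sym q }
      ; trans = λ { (p , q) (p' , q') → trans p p' , trans q q' } } }

  -- Disjoint union of m copies of Haar(H,T), i.e. K̄_m ≀ Haar(H,T)
  copiesSetoid : ℕ → (H : Carrier → Set) → Setoid 0ℓ 0ℓ
  copiesSetoid m H = record
    { Carrier = Fin m × SubVertex H
    ; _≈_ = λ u v → (proj₁ u ≡ proj₁ v) × Setoid._≈_ (subVertexSetoid H) (proj₂ u) (proj₂ v)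
    ; isEquivalence = record
      { refl = refl , refl , refl
      ; sym = λ { (p , q , r) → sym p , sym q , sym r }
      ; trans = λ { (p , q , r) (p' , q' , r') → trans p p' , trans q q' , trans r r' } } }

  CopiesAdj : (m : ℕ) → (H : Carrier → Set) → (Carrier → Set) → Rel (Fin m × SubVertex H) 0ℓ
  CopiesAdj m H T (i , u) (j , v) = (i ≡ j) × SubHaarAdj H T u v

  QuotientSetoid : (H : Carrier → Set) → (∀ {x} → H x → H (- x)) →
                   (∀ {x y} → H x → H y → H (x + y)) → H 0# →
                   Setoid 0ℓ 0ℓ
  QuotientSetoid H hneg hplus h0 = record
    { Carrier = Carrier
    ; _≈_ = λ x y → H (x - y)
    ; isEquivalence = record
      { refl = λ {x} → PE.subst H (sym (inverseʳ x)) h0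
      ; sym = λ {x} {y} p → PE.subst H (symEq x y) (hneg p)
      ; trans = λ {x} {y} {z} p q → PE.subst H (transEq x y z) (hplus p q) } }
    where
      open IsAbelianGroup isAbelianGroup using (inverseʳ; inverseˡ; assoc; identityˡ)
      AG : AbelianGroup 0ℓ 0ℓ
      AG = record { isAbelianGroup = isAbelianGroup }
      symEq : ∀ x y → - (x - y) ≡ y - x
      symEq = AGP.⁻¹-anti-homo‿- AG
      transEq : ∀ x y z → (x - y) + (y - z) ≡ x - z
      transEq x y z = trans (assoc x (- y) (y - z))
        (cong (x +_) (trans (sym (assoc (- y) y (- z)))
          (trans (cong (_+ (- z)) (inverseˡ y)) (identityˡ (- z)))))

{-# OPTIONS --safe #-}
module Submission where

-- Put T = a + S. The map (b , x) ↦ (b , x + b·a) is an isomorphism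
-- Haar(A,S) ≅ Haar(A,T), so (0,0) and (1,0) are joined in Haar(A,T). For a
-- fixed t₀ ∈ T the "level" (0,x) ↦ x, (1,x) ↦ x − t₀ changes by an element of
-- T − T along every edge; comparing the levels of (0,0) and (1,0) gives
-- t₀ ∈ H, hence T ⊆ H. So every edge moves the A-coordinate inside a coset of
-- H, while the two-step walks (0,x) — (1,x+t) — (0,x+t−t') realise all
-- generators of H: the components are the sets ℤ₂ × (x + H). As H is a
-- decidable subset of the finite group A, there are finitely many cosets, and
-- a choice of coset representatives identifies Haar(A,T) with m copies of
-- Haar(H,T).

open import Defs
open import Level using (0ℓ)
open import Function.Base using (_∘_; id)
open import Data.Bool using (true; false)
open import Data.Nat as ℕ using (ℕ; zero; suc; z≤n; s≤s)
import Data.Nat.Properties as ℕ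
open import Data.Fin as Fin using (Fin; zero; suc; toℕ)
import Data.Fin.Properties as Fin
open import Data.List using (List; []; _∷_; _++_; take; drop; length; map; foldr)
import Data.List.Properties as List
open import Data.List.Relation.Unary.All as All using (All; []; _∷_)
import Data.List.Relation.Unary.All.Properties as All
open import Data.Product using (Σ; ∃; ∃₂; ∃-syntax; _×_; _,_; proj₁; proj₂; map₁)
open import Data.Sum using (_⊎_; inj₁; inj₂)
open import Data.Empty using (⊥-elim)
open import Relation.Nullary using (¬_; Dec; yes; no; contradiction)
open import Relation.Nullary.Decidable using (_×-dec_; _⊎-dec_; map′; via-injection)
open import Relation.Unary using (Decidable)
open import Relation.Binary using (Setoid; IsEquivalence; IsDecEquivalence; Rel)
  renaming (Decidable to Decidable₂)
import Relation.Binary.Construct.On as On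
open import Relation.Binary.PropositionalEquality
  using (_≡_; refl; sym; trans; cong; cong₂; subst; subst₂; setoid; module ≡-Reasoning)
open import Relation.Binary.Construct.Closure.ReflexiveTransitive
  using (ε; _◅_; _◅◅_; gmap; fold; reverse)
open import Algebra.Structures using (IsAbelianGroup)
open import Algebra.Bundles using (AbelianGroup)
import Algebra.Properties.AbelianGroup as AbelianGroupProperties
import Algebra.Properties.Group as GroupProperties
open import Function.Bundles using (Inverse; _↔_; _⇔_; mk⇔; Injection)
open import Function.Properties.Inverse using (↔⇒↣)
open import Function.Construct.Composition using (_⇔-∘_)

record Classification {n : ℕ} (_~_ : Rel (Fin n) 0ℓ) : Set where
  field
    classes     : ℕ
    classOf     : Fin n → Fin classes
    rep         : Fin classes → Fin n
    classOf-rep : ∀ k → classOf (rep k) ≡ k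
    ≡⇒~         : ∀ {i j} → classOf i ≡ classOf j → i ~ j
    ~⇒≡         : ∀ {i j} → i ~ j → classOf i ≡ classOf j

module _ {n : ℕ} {_~_ : Rel (Fin (suc n)) 0ℓ} (eqv : IsEquivalence _~_)
         (C : Classification (λ i j → suc i ~ suc j)) where
  open IsEquivalence eqv renaming (refl to ~-refl; sym to ~-sym; trans to ~-trans)
  open Classification C

  classify-joining : ∀ {i} → zero ~ suc i → Classification _~_
  classify-joining {i} 0~i = record
    { classes = classes ; classOf = classOf′ ; rep = suc ∘ rep ; classOf-rep = classOf-rep
    ; ≡⇒~ = ≡⇒~′ ; ~⇒≡ = ~⇒≡′ }
    where
      classOf′ : Fin (suc n) → Fin classes
      classOf′ zero    = classOf i
      classOf′ (suc j) = classOf j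
      ≡⇒~′ : ∀ {j k} → classOf′ j ≡ classOf′ k → j ~ k
      ≡⇒~′ {zero}  {zero}  _ = ~-refl
      ≡⇒~′ {zero}  {suc k} e = ~-trans 0~i (≡⇒~ e)
      ≡⇒~′ {suc j} {zero}  e = ~-trans (≡⇒~ e) (~-sym 0~i)
      ≡⇒~′ {suc j} {suc k} e = ≡⇒~ e
      ~⇒≡′ : ∀ {j k} → j ~ k → classOf′ j ≡ classOf′ k
      ~⇒≡′ {zero}  {zero}  _ = refl
      ~⇒≡′ {zero}  {suc k} p = ~⇒≡ (~-trans (~-sym 0~i) p)
      ~⇒≡′ {suc j} {zero}  p = ~⇒≡ (~-trans p 0~i)
      ~⇒≡′ {suc j} {suc k} p = ~⇒≡ p

  classify-new : (∀ i → ¬ zero ~ suc i) → Classification _~_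
  classify-new 0≁ = record
    { classes = suc classes ; classOf = classOf′ ; rep = rep′ ; classOf-rep = classOf-rep′
    ; ≡⇒~ = ≡⇒~′ ; ~⇒≡ = ~⇒≡′ }
    where
      classOf′ : Fin (suc n) → Fin (suc classes)
      classOf′ zero    = zero
      classOf′ (suc j) = suc (classOf j)
      rep′ : Fin (suc classes) → Fin (suc n)
      rep′ zero    = zero
      rep′ (suc k) = suc (rep k)
      classOf-rep′ : ∀ k → classOf′ (rep′ k) ≡ k
      classOf-rep′ zero    = refl
      classOf-rep′ (suc k) = cong suc (classOf-rep k)
      ≡⇒~′ : ∀ {j k} → classOf′ j ≡ classOf′ k → j ~ k
      ≡⇒~′ {zero}  {zero}  _ = ~-refl
      ≡⇒~′ {suc j} {suc k} e = ≡⇒~ (Fin.suc-injective e)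
      ~⇒≡′ : ∀ {j k} → j ~ k → classOf′ j ≡ classOf′ k
      ~⇒≡′ {zero}  {zero}  _ = refl
      ~⇒≡′ {zero}  {suc k} p = contradiction p (0≁ k)
      ~⇒≡′ {suc j} {zero}  p = contradiction (~-sym p) (0≁ j)
      ~⇒≡′ {suc j} {suc k} p = cong suc (~⇒≡ p)

classify : ∀ {n} {_~_ : Rel (Fin n) 0ℓ} → IsDecEquivalence _~_ → Classification _~_
classify {zero} _ = record
  { classes = 0 ; classOf = id ; rep = id ; classOf-rep = λ _ → refl
  ; ≡⇒~ = λ { {()} } ; ~⇒≡ = λ { {()} } }
classify {suc n} {_~_} isDecEq = extend (classify restricted) (Fin.any? (λ i → zero ≟ suc i))
  where
    open IsDecEquivalence isDecEq using (isEquivalence; _≟_)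
    restricted : IsDecEquivalence (λ i j → suc i ~ suc j)
    restricted = On.isDecEquivalence suc isDecEq
    extend : Classification (λ i j → suc i ~ suc j) → Dec (∃ λ i → zero ~ suc i) → Classification _~_
    extend C (yes (_ , 0~i)) = classify-joining isEquivalence C 0~i
    extend C (no 0≁)         = classify-new isEquivalence C (λ i 0~i → 0≁ (i , 0~i))

finiteQuotient : ∀ {n} (X : Setoid 0ℓ 0ℓ) → Decidable₂ (Setoid._≈_ X) → Setoid.Carrier X ↔ Fin n →
                 Σ ℕ λ m → Inverse X (setoid (Fin m))
finiteQuotient X _≟_ e = classes , record
  { to        = to
  ; from      = from
  ; to-cong   = to-cong
  ; from-cong = reflexive ∘ cong from
  ; inverse   = (λ y≈from-k → trans (to-cong y≈from-k) (to-from _))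
              , (λ { refl → from-to _ }) }
  where
    open Setoid X using (Carrier; _≈_; reflexive; isEquivalence)
    module E = Inverse e
    isDecEquivalence : IsDecEquivalence _≈_
    isDecEquivalence = record { isEquivalence = isEquivalence ; _≟_ = _≟_ }
    open Classification (classify (On.isDecEquivalence E.from isDecEquivalence))
    to : Carrier → Fin classes
    to = classOf ∘ E.to
    from : Fin classes → Carrier
    from = E.from ∘ rep
    to-cong : ∀ {x y} → x ≈ y → to x ≡ to y
    to-cong {x} {y} x≈y =
      ~⇒≡ (subst₂ _≈_ (sym (E.strictlyInverseʳ x)) (sym (E.strictlyInverseʳ y)) x≈y)
    to-from : ∀ k → to (from k) ≡ k
    to-from k = trans (cong classOf (E.strictlyInverseˡ (rep k))) (classOf-rep k)
    from-to : ∀ x → from (to x) ≈ x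
    from-to x = subst (from (to x) ≈_) (E.strictlyInverseʳ x) (≡⇒~ (classOf-rep (to x)))

module FiniteAbelianGroupProperties (G : FiniteAbelianGroup) where
  open FiniteAbelianGroup G public
  open IsAbelianGroup isAbelianGroup public
    using (assoc; comm; identityˡ; identityʳ; inverseˡ)

  abelianGroup : AbelianGroup 0ℓ 0ℓ
  abelianGroup = record { isAbelianGroup = isAbelianGroup }

  open AbelianGroupProperties abelianGroup public using (⁻¹-anti-homo‿-; xyx⁻¹≈y; ⁻¹-∙-comm)
  open GroupProperties (AbelianGroup.group abelianGroup) public
    using (⁻¹-involutive; ε⁻¹≈ε; ∙-cancelˡ; //-rightDividesˡ)

  x+[y-x]≡y : ∀ x y → x + (y - x) ≡ y
  x+[y-x]≡y x y = trans (comm x (y - x)) (//-rightDividesˡ x y)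

  0-[0-x]≡x : ∀ x → 0# - (0# - x) ≡ x
  0-[0-x]≡x x = begin
    0# - (0# - x) ≡⟨ identityˡ _ ⟩
    - (0# - x)    ≡⟨ cong -_ (identityˡ (- x)) ⟩
    - - x         ≡⟨ ⁻¹-involutive x ⟩
    x             ∎
    where open ≡-Reasoning

  g-[g+t]≡-t : ∀ g t → g - (g + t) ≡ - t
  g-[g+t]≡-t g t = trans (sym (⁻¹-anti-homo‿- (g + t) g)) (cong -_ (xyx⁻¹≈y g t))

  [g+t]-u-g≡t-u : ∀ g t u → ((g + t) - u) - g ≡ t - u
  [g+t]-u-g≡t-u g t u = trans (cong (_- g) (assoc g t (- u))) (xyx⁻¹≈y g (t - u))

  g-[[g+t]-u]≡u-t : ∀ g t u → g - ((g + t) - u) ≡ u - t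
  g-[[g+t]-u]≡u-t g t u = begin
    g - ((g + t) - u)     ≡⟨ ⁻¹-anti-homo‿- ((g + t) - u) g ⟨
    - (((g + t) - u) - g) ≡⟨ cong -_ ([g+t]-u-g≡t-u g t u) ⟩
    - (t - u)             ≡⟨ ⁻¹-anti-homo‿- t u ⟩
    u - t                 ∎
    where open ≡-Reasoning

  enum-injective : ∀ {x y} → Inverse.to enum x ≡ Inverse.to enum y → x ≡ y
  enum-injective = Injection.injective (↔⇒↣ enum)

  infix 4 _≟_
  _≟_ : (x y : Carrier) → Dec (x ≡ y)
  _≟_ = via-injection (↔⇒↣ enum) Fin._≟_

  ∃? : {P : Carrier → Set} → Decidable P → Dec (∃ P)
  ∃? {P} P? = map′ (λ (i , p) → Inverse.from enum i , p)
                   (λ (x , p) → Inverse.to enum x , subst P (sym (Inverse.strictlyInverseʳ enum x)) p)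
                   (Fin.any? (P? ∘ Inverse.from enum))

  translate-dec : ∀ {S} → Decidable S → ∀ a → Decidable (translate G a S)
  translate-dec S? a x = ∃? λ s → S? s ×-dec x ≟ a + s

  diffSet-dec : ∀ {T} → Decidable T → Decidable (diffSet G T)
  diffSet-dec T? z = ∃? λ x → ∃? λ y → T? x ×-dec T? y ×-dec z ≟ x - y

module GeneratedDecidable (G : FiniteAbelianGroup) {X : FiniteAbelianGroup.Carrier G → Set}
                          (X? : Decidable X) where
  open FiniteAbelianGroupProperties G

  Signed : Carrier → Set
  Signed d = X d ⊎ X (- d)

  Signed? : Decidable Signed
  Signed? d = X? d ⊎-dec X? (- d)

  Signed-neg : ∀ {d} → Signed d → Signed (- d)
  Signed-neg (inj₁ x) = inj₂ (subst X (sym (⁻¹-involutive _)) x)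
  Signed-neg (inj₂ x) = inj₁ x

  Signed⇒Generated : ∀ {d} → Signed d → Generated G X d
  Signed⇒Generated (inj₁ x) = gen x
  Signed⇒Generated (inj₂ x) = subst (Generated G X) (⁻¹-involutive _) (neg (gen x))

  sum : List Carrier → Carrier
  sum = foldr _+_ 0#

  sum-++ : ∀ xs ys → sum (xs ++ ys) ≡ sum xs + sum ys
  sum-++ []       ys = sym (identityˡ _)
  sum-++ (x ∷ xs) ys = trans (cong (x +_) (sum-++ xs ys)) (sym (assoc x _ _))

  sum-map-neg : ∀ xs → sum (map -_ xs) ≡ - sum xs
  sum-map-neg []       = sym ε⁻¹≈ε
  sum-map-neg (x ∷ xs) = trans (cong (- x +_) (sum-map-neg xs)) (⁻¹-∙-comm x _)

  Generated⇒sum : ∀ {x} → Generated G X x → ∃ λ ts → All Signed ts × sum ts ≡ x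
  Generated⇒sum (gen x) = _ ∷ [] , inj₁ x ∷ [] , identityʳ _
  Generated⇒sum zero = [] , [] , refl
  Generated⇒sum (plus p q) with Generated⇒sum p | Generated⇒sum q
  ... | ts , signed-ts , refl | us , signed-us , refl =
    ts ++ us , All.++⁺ signed-ts signed-us , sum-++ ts us
  Generated⇒sum (neg p) with Generated⇒sum p
  ... | ts , signed , refl = map -_ ts , All.map⁺ (All.map Signed-neg signed) , sum-map-neg ts

  SumOfAtMost : ℕ → Carrier → Set
  SumOfAtMost zero    x = x ≡ 0#
  SumOfAtMost (suc k) x = SumOfAtMost k x ⊎ ∃₂ λ d y → Signed d × SumOfAtMost k y × x ≡ d + y

  SumOfAtMost? : ∀ k → Decidable (SumOfAtMost k)
  SumOfAtMost? zero    x = x ≟ 0#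
  SumOfAtMost? (suc k) x = SumOfAtMost? k x ⊎-dec
    ∃? λ d → ∃? λ y → Signed? d ×-dec SumOfAtMost? k y ×-dec x ≟ d + y

  SumOfAtMost⇒Generated : ∀ k {x} → SumOfAtMost k x → Generated G X x
  SumOfAtMost⇒Generated zero    refl = zero
  SumOfAtMost⇒Generated (suc k) (inj₁ s) = SumOfAtMost⇒Generated k s
  SumOfAtMost⇒Generated (suc k) (inj₂ (_ , _ , signed , s , refl)) =
    plus (Signed⇒Generated signed) (SumOfAtMost⇒Generated k s)

  sum-SumOfAtMost : ∀ {k ts} → length ts ℕ.≤ k → All Signed ts → SumOfAtMost k (sum ts)
  sum-SumOfAtMost {zero}  {[]}     _         []       = refl
  sum-SumOfAtMost {suc k} {[]}     _         []       = inj₁ (sum-SumOfAtMost z≤n [])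
  sum-SumOfAtMost {suc k} {t ∷ ts} (s≤s len) (st ∷ s) =
    inj₂ (t , sum ts , st , sum-SumOfAtMost len s , refl)

  -- Two of the |A| + 1 prefix sums of length at most |A| coincide; cut out the block between them.
  shorter-sum : ∀ {ts} → size ℕ.< length ts → All Signed ts →
                ∃ λ us → length us ℕ.< length ts × All Signed us × sum us ≡ sum ts
  shorter-sum {ts} size<L signed
    with Fin.pigeonhole (ℕ.n<1+n size) (λ k → Inverse.to enum (sum (take (toℕ k) ts)))
  ... | i , j , i<j , same-prefix-sum =
    take (toℕ i) ts ++ drop (toℕ j) ts , shorter ,
    All.++⁺ (All.take⁺ (toℕ i) signed) (All.drop⁺ (toℕ j) signed) , same-sum
    where
      L = length ts
      j≤L : toℕ j ℕ.≤ L
      j≤L = ℕ.≤-trans (ℕ.≤-pred (Fin.toℕ<n j)) (ℕ.<⇒≤ size<L)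
      shorter : length (take (toℕ i) ts ++ drop (toℕ j) ts) ℕ.< L
      shorter = begin-strict
        length (take (toℕ i) ts ++ drop (toℕ j) ts)    ≡⟨ List.length-++ (take (toℕ i) ts) ⟩
        length (take (toℕ i) ts) ℕ.+ length (drop (toℕ j) ts)
          ≡⟨ cong₂ ℕ._+_ (List.length-take (toℕ i) ts) (List.length-drop (toℕ j) ts) ⟩
        toℕ i ℕ.⊓ L ℕ.+ (L ℕ.∸ toℕ j)                 ≤⟨ ℕ.+-monoˡ-≤ _ (ℕ.m⊓n≤m (toℕ i) L) ⟩
        toℕ i ℕ.+ (L ℕ.∸ toℕ j)                       <⟨ ℕ.+-monoˡ-< _ i<j ⟩
        toℕ j ℕ.+ (L ℕ.∸ toℕ j)                       ≡⟨ ℕ.m+[n∸m]≡n j≤L ⟩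
        L                                             ∎
        where open ℕ.≤-Reasoning
      same-sum : sum (take (toℕ i) ts ++ drop (toℕ j) ts) ≡ sum ts
      same-sum = begin
        sum (take (toℕ i) ts ++ drop (toℕ j) ts)      ≡⟨ sum-++ (take (toℕ i) ts) _ ⟩
        sum (take (toℕ i) ts) + sum (drop (toℕ j) ts) ≡⟨ cong (_+ _) (enum-injective same-prefix-sum) ⟩
        sum (take (toℕ j) ts) + sum (drop (toℕ j) ts) ≡⟨ sum-++ (take (toℕ j) ts) _ ⟨
        sum (take (toℕ j) ts ++ drop (toℕ j) ts)      ≡⟨ cong sum (List.take++drop≡id (toℕ j) ts) ⟩
        sum ts                                        ∎
        where open ≡-Reasoning

  sum-SumOfAtMost-size : ∀ n {ts} → length ts ℕ.≤ n → All Signed ts → SumOfAtMost size (sum ts)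
  sum-SumOfAtMost-size n {ts} len signed with length ts ℕ.≤? size
  ... | yes short = sum-SumOfAtMost short signed
  sum-SumOfAtMost-size zero    len signed | no long = contradiction (ℕ.≤-trans len z≤n) long
  sum-SumOfAtMost-size (suc n) len signed | no long with shorter-sum (ℕ.≰⇒> long) signed
  ... | us , us<ts , signed-us , same =
    subst (SumOfAtMost size) same (sum-SumOfAtMost-size n (ℕ.≤-pred (ℕ.≤-trans us<ts len)) signed-us)

  Generated-dec : Decidable (Generated G X)
  Generated-dec x = map′ (SumOfAtMost⇒Generated size) Generated⇒SumOfAtMost (SumOfAtMost? size x)
    where
      Generated⇒SumOfAtMost : Generated G X x → SumOfAtMost size x
      Generated⇒SumOfAtMost g with Generated⇒sum g
      ... | ts , signed , sum≡x =
        subst (SumOfAtMost size) sum≡x (sum-SumOfAtMost-size (length ts) ℕ.≤-refl signed)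

module HaarGraph (G : FiniteAbelianGroup) where
  open FiniteAbelianGroupProperties G

  HaarAdj-sym : ∀ {S u v} → HaarAdj G S u v → HaarAdj G S v u
  HaarAdj-sym {u = false , _} {true , _}  e = e
  HaarAdj-sym {u = true , _}  {false , _} e = e

  shift : Carrier → Vertex G → Vertex G
  shift a (false , x) = false , x
  shift a (true , x)  = true , x + a

  Connected-translate : ∀ {S} a {u v} → Connected G S u v →
                        Connected G (translate G a S) (shift a u) (shift a v)
  Connected-translate {S} a = gmap (shift a) edge
    where
      [g+s]+a≡g+[a+s] : ∀ g s → (g + s) + a ≡ g + (a + s)
      [g+s]+a≡g+[a+s] g s = trans (assoc g s a) (cong (g +_) (comm s a))
      edge : ∀ {u v} → HaarAdj G S u v → HaarAdj G (translate G a S) (shift a u) (shift a v)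
      edge {false , g} {true , _}  (s , s∈S , refl) = a + s , (s , s∈S , refl) , [g+s]+a≡g+[a+s] g s
      edge {true , _}  {false , g} (s , s∈S , refl) = a + s , (s , s∈S , refl) , [g+s]+a≡g+[a+s] g s

  level : Carrier → Vertex G → Carrier
  level t₀ (false , x) = x
  level t₀ (true , x)  = x - t₀

  module _ {T : Carrier → Set} {t₀ : Carrier} (t₀∈T : T t₀) where
    private
      H = Generated G (diffSet G T)
      module H/ = Setoid (QuotientSetoid G H neg plus zero)

    level-edge : ∀ {u v} → HaarAdj G T u v → diffSet G T (level t₀ u - level t₀ v)
    level-edge {false , g} {true , _}  (t , t∈T , refl) = t₀ , t , t₀∈T , t∈T , g-[[g+t]-u]≡u-t g t t₀
    level-edge {true , _}  {false , g} (t , t∈T , refl) = t , t₀ , t∈T , t₀∈T , [g+t]-u-g≡t-u g t t₀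

    Connected⇒level : ∀ {u v} → Connected G T u v → H (level t₀ u - level t₀ v)
    Connected⇒level =
      fold (λ u v → H (level t₀ u - level t₀ v)) (λ e p → H/.trans (gen (level-edge e)) p) H/.refl

    ⊆-generated-by-differences : Connected G T (false , 0#) (true , 0#) → ∀ {t} → T t → H t
    ⊆-generated-by-differences 0~1 {t} t∈T =
      subst H (//-rightDividesˡ t₀ t) (plus (gen (t , t₀ , t∈T , t₀∈T , refl)) t₀∈H)
      where
        t₀∈H : H t₀
        t₀∈H = subst H (0-[0-x]≡x t₀) (Connected⇒level 0~1)

  module Components {T : Carrier → Set} {t₀ : Carrier} (t₀∈T : T t₀)
                    (T⊆H : ∀ {t} → T t → Generated G (diffSet G T) t) where
    H : Carrier → Set
    H = Generated G (diffSet G T)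

    private module H/ = Setoid (QuotientSetoid G H neg plus zero)

    edge⇒coset : ∀ {u v} → HaarAdj G T u v → H (proj₂ u - proj₂ v)
    edge⇒coset {false , g} {true , _}  (t , t∈T , refl) =
      subst H (sym (g-[g+t]≡-t g t)) (neg (T⊆H t∈T))
    edge⇒coset {true , _}  {false , g} (t , t∈T , refl) =
      subst H (sym (xyx⁻¹≈y g t)) (T⊆H t∈T)

    Connected⇒coset : ∀ {u v} → Connected G T u v → H (proj₂ u - proj₂ v)
    Connected⇒coset =
      fold (λ u v → H (proj₂ u - proj₂ v)) (λ e p → H/.trans (edge⇒coset e) p) H/.refl

    walk-by : ∀ {h} → H h → ∀ x → Connected G T (false , x) (false , x + h)
    walk-by (gen (t , t′ , t∈T , t′∈T , refl)) x = up ◅◅ down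
      where
        up : Connected G T (false , x) (true , x + t)
        up = (t , t∈T , refl) ◅ ε
        down : Connected G T (true , x + t) (false , x + (t - t′))
        down = (t′ , t′∈T , x+t≡[x+[t-t′]]+t′) ◅ ε
          where
            x+t≡[x+[t-t′]]+t′ : x + t ≡ (x + (t - t′)) + t′
            x+t≡[x+[t-t′]]+t′ = sym (trans (assoc x (t - t′) t′) (cong (x +_) (//-rightDividesˡ t′ t)))
    walk-by zero x = subst (λ y → Connected G T (false , x) (false , y)) (sym (identityʳ x)) ε
    walk-by (plus {h} {h′} p q) x =
      walk-by p x ◅◅
      subst (λ y → Connected G T (false , x + h) (false , y)) (assoc x h h′) (walk-by q (x + h))
    walk-by (neg {h} p) x =
      subst (λ y → Connected G T (false , y) (false , x - h)) (//-rightDividesˡ h x)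
            (reverse HaarAdj-sym (walk-by p (x - h)))

    switch-side : ∀ b x → Connected G T (false , x) (b , x)
    switch-side false x = ε
    switch-side true  x =
      walk-by (neg (T⊆H t₀∈T)) x ◅◅ (t₀ , t₀∈T , sym (//-rightDividesˡ t₀ x)) ◅ ε

    coset⇒Connected : ∀ u v → H (proj₂ u - proj₂ v) → Connected G T u v
    coset⇒Connected (b , x) (c , y) x-y∈H =
      reverse HaarAdj-sym (switch-side b x) ◅◅
      subst (λ z → Connected G T (false , x) (false , z)) (x+[y-x]≡y x y) (walk-by (H/.sym x-y∈H) x) ◅◅
      switch-side c y

    Connected⇔coset : ∀ u v → Connected G T u v ⇔ H (proj₂ u - proj₂ v)
    Connected⇔coset u v = mk⇔ Connected⇒coset (coset⇒Connected u v)

  module Copies {H : Carrier → Set} (H-neg : ∀ {x} → H x → H (- x))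
                (H-plus : ∀ {x y} → H x → H y → H (x + y)) (H-0 : H 0#)
                {T : Carrier → Set} (T⊆H : ∀ {t} → T t → H t)
                {m : ℕ} (cosets : Inverse (QuotientSetoid G H H-neg H-plus H-0) (setoid (Fin m))) where
    private module H/ = Setoid (QuotientSetoid G H H-neg H-plus H-0)

    class : Carrier → Fin m
    class = Inverse.to cosets

    rep : Fin m → Carrier
    rep = Inverse.from cosets

    class-+ : ∀ x {h} → H h → class (x + h) ≡ class x
    class-+ x {h} h∈H = Inverse.to-cong cosets (subst H (sym (xyx⁻¹≈y x h)) h∈H)

    class-rep-+ : ∀ k {h} → H h → class (rep k + h) ≡ k
    class-rep-+ k h∈H = trans (class-+ (rep k) h∈H) (Inverse.strictlyInverseˡ cosets k)

    offset∈H : ∀ x → H (x - rep (class x))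
    offset∈H x = H/.sym (Inverse.strictlyInverseʳ cosets x)

    copies : Inverse (copiesSetoid G m H) (setoid (Vertex G))
    copies = record
      { to        = λ { (k , b , h , _) → b , rep k + h }
      ; from      = λ { (b , x) → class x , b , x - rep (class x) , offset∈H x }
      ; to-cong   = λ { (refl , refl , refl) → refl }
      ; from-cong = λ { refl → refl , refl , refl }
      ; inverse   = (λ { {b , x} (refl , refl , refl) → cong (b ,_) (x+[y-x]≡y (rep (class x)) x) })
                  , (λ { {k , b , h , h∈H} refl → class-rep-+ k h∈H , refl , offset-rep k h∈H }) }
      where
        offset-rep : ∀ k {h} → H h → (rep k + h) - rep (class (rep k + h)) ≡ h
        offset-rep k {h} h∈H =
          trans (cong (λ l → (rep k + h) - rep l) (class-rep-+ k h∈H)) (xyx⁻¹≈y (rep k) h)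

    same-copy⇔edge : ∀ i j {g h} → H g → H h →
                     (i ≡ j × ∃ λ t → T t × h ≡ g + t) ⇔ (∃ λ t → T t × rep j + h ≡ (rep i + g) + t)
    same-copy⇔edge i j {g} {h} g∈H h∈H = mk⇔ to from
      where
        to : (i ≡ j × ∃ λ t → T t × h ≡ g + t) → ∃ λ t → T t × rep j + h ≡ (rep i + g) + t
        to (refl , t , t∈T , refl) = t , t∈T , sym (assoc (rep i) g t)
        from : (∃ λ t → T t × rep j + h ≡ (rep i + g) + t) → i ≡ j × ∃ λ t → T t × h ≡ g + t
        from (t , t∈T , e) = i≡j , t , t∈T , ∙-cancelˡ (rep i) h (g + t) rep-i+h≡rep-i+[g+t]
          where
            open ≡-Reasoning
            i≡j : i ≡ j
            i≡j = begin
              i                          ≡⟨ class-rep-+ i g∈H ⟨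
              class (rep i + g)          ≡⟨ class-+ (rep i + g) (T⊆H t∈T) ⟨
              class ((rep i + g) + t)    ≡⟨ cong class e ⟨
              class (rep j + h)          ≡⟨ class-rep-+ j h∈H ⟩
              j                          ∎
            rep-i+h≡rep-i+[g+t] : rep i + h ≡ rep i + (g + t)
            rep-i+h≡rep-i+[g+t] = begin
              rep i + h                  ≡⟨ cong (λ k → rep k + h) i≡j ⟩
              rep j + h                  ≡⟨ e ⟩
              (rep i + g) + t            ≡⟨ assoc (rep i) g t ⟩
              rep i + (g + t)            ∎

    copies-adjacency : ∀ u v →
      CopiesAdj G m H T u v ⇔ HaarAdj G T (Inverse.to copies u) (Inverse.to copies v)
    copies-adjacency (_ , false , _)     (_ , false , _)     = mk⇔ proj₂ ⊥-elim
    copies-adjacency (_ , true , _)      (_ , true , _)      = mk⇔ proj₂ ⊥-elim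
    copies-adjacency (i , false , _ , g∈H) (j , true , _ , h∈H) = same-copy⇔edge i j g∈H h∈H
    copies-adjacency (i , true , _ , g∈H) (j , false , _ , h∈H) =
      same-copy⇔edge j i h∈H g∈H ⇔-∘ mk⇔ (map₁ sym) (map₁ sym)

mainTheorem12 :
  (G : FiniteAbelianGroup) → let open FiniteAbelianGroup G in
  (S : Carrier → Set) → Decidable S →
  (∃[ s ] S s) →
  (∃[ x ] ¬ S x) →
  (∃[ u ] ∃[ v ] ¬ Connected G S u v) →
  (a : Carrier) → Connected G S (false , 0#) (true , - a) →
  let T = translate G a S
      H = Generated G (diffSet G T)
  in (∀ u v → Connected G T u v ⇔ H (proj₂ u - proj₂ v))
     × Σ ℕ λ m →
         Inverse (QuotientSetoid G H neg plus zero) (setoid (Fin m))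
         × Σ (Inverse (copiesSetoid G m H) (setoid (Vertex G))) λ φ →
             ∀ u v → CopiesAdj G m H T u v ⇔ HaarAdj G T (Inverse.to φ u) (Inverse.to φ v)
mainTheorem12 G S S? (s₀ , s₀∈S) _ _ a 0~1-a =
  Connected⇔coset , m , cosets , copies , copies-adjacency
  where
    open FiniteAbelianGroupProperties G
    open HaarGraph G
    T : Carrier → Set
    T = translate G a S
    t₀∈T : T (a + s₀)
    t₀∈T = s₀ , s₀∈S , refl
    0~1 : Connected G T (false , 0#) (true , 0#)
    0~1 = subst (λ x → Connected G T (false , 0#) (true , x)) (inverseˡ a) (Connected-translate a 0~1-a)
    T⊆H : ∀ {t} → T t → Generated G (diffSet G T) t
    T⊆H = ⊆-generated-by-differences t₀∈T 0~1
    open Components t₀∈T T⊆H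
    open GeneratedDecidable G (diffSet-dec (translate-dec S? a)) using (Generated-dec)
    quotient : Σ ℕ λ m → Inverse (QuotientSetoid G H neg plus zero) (setoid (Fin m))
    quotient = finiteQuotient (QuotientSetoid G H neg plus zero) (λ x y → Generated-dec (x - y)) enum
    m : ℕ
    m = proj₁ quotient
    cosets : Inverse (QuotientSetoid G H neg plus zero) (setoid (Fin m))
    cosets = proj₂ quotient
    open Copies neg plus zero T⊆H cosets
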